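{- Let $\Phi$ be a set of $\mathcal H^{*\dagger}$-formulas. If $\Phi$ has a model with three or more elements, then $\Phi$ has arbitrarily large models.
   Context: Fix a countably infinite set $\mathbf{P}$ of atoms. A literal is $p$ or $\bar p$ with $p$ an atom. A structure $\mathfrak{A}$ consists of a non-empty set $A$ together with a subset $p^{\mathfrak A}\subseteq A$ for every atom $p$; put $\bar p^{\mathfrak A}=A\setminus p^{\mathfrak A}$. An e-term is a literal or an expression $\forall \ell$ or $\overline{\forall\ell}$ with $\ell$ a literal; $(\forall \ell)^{\mathfrak A}=\{a\in A : a=b \text{ for all } b\in \ell^{\mathfrak A}\}$, $(\overline{\forall\ell})^{\mathfrak A}=A\setminus(\forall\ell)^{\mathfrak A}$. An $\mathcal H^{*\dagger}$-formula is an expression $\forall(e,f)$ or $\exists(e,f)$ with $e,f$ e-terms. $\mathfrak A\models\forall(e,f)$ iff $e^{\mathfrak A}\subseteq f^{\mathfrak A}$; $\mathfrak A\models\exists(e,f)$ iff $e^{\mathfrak A}\cap f^{\mathfrak A}\ne\emptyset$. A model of $\Phi$ is a structure satisfying every formula of $\Phi$. -}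

module Defs where

open import Data.Nat using (ℕ)
open import Data.Fin using (Fin)
open import Data.Product using (Σ; _×_; ∃)
open import Data.Empty using (⊥)
open import Relation.Nullary using (¬_)
open import Relation.Binary.PropositionalEquality using (_≡_)
open import Function.Definitions using (Injective)
open import Level using (Level; suc; _⊔_) renaming (zero to lzero)

Atom : Set
Atom = ℕ

data Literal : Set where
  pos : Atom → Literal
  neg : Atom → Literal

data ETerm : Set where
  lit   : Literal → ETerm
  all   : Literal → ETerm
  noall : Literal → ETerm

data Formula : Set where
  forallF : ETerm → ETerm → Formula
  existsF : ETerm → ETerm → Formula

record Structure : Set₁ where
  field
    Carrier : Set
    inhabitant : Carrier
    interp : Atom → Carrier → Set
open Structure public

litI : (𝔄 : Structure) → Literal → Carrier 𝔄 → Set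
litI 𝔄 (pos p) a = interp 𝔄 p a
litI 𝔄 (neg p) a = ¬ interp 𝔄 p a

etermI : (𝔄 : Structure) → ETerm → Carrier 𝔄 → Set
etermI 𝔄 (lit l) a = litI 𝔄 l a
etermI 𝔄 (all l) a = (b : Carrier 𝔄) → litI 𝔄 l b → a ≡ b
etermI 𝔄 (noall l) a = ¬ ((b : Carrier 𝔄) → litI 𝔄 l b → a ≡ b)

_⊨_ : Structure → Formula → Set
𝔄 ⊨ forallF e f = (a : Carrier 𝔄) → etermI 𝔄 e a → etermI 𝔄 f a
𝔄 ⊨ existsF e f = Σ (Carrier 𝔄) (λ a → etermI 𝔄 e a × etermI 𝔄 f a)

FormulaSet : Set₁
FormulaSet = Formula → Set

IsModel : Structure → FormulaSet → Set
IsModel 𝔄 Φ = (φ : Formula) → Φ φ → 𝔄 ⊨ φ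

AtLeast : ℕ → Structure → Set
AtLeast n 𝔄 = Σ (Fin n → Carrier 𝔄) (λ f → Injective _≡_ _≡_ f)

ThreeOrMore : Structure → Set
ThreeOrMore 𝔄 = Σ (Carrier 𝔄) λ a → Σ (Carrier 𝔄) λ b → Σ (Carrier 𝔄) λ c →
  ¬ a ≡ b × ¬ a ≡ c × ¬ b ≡ c

module Submission where

-- A model 𝔄 of Φ with at least three points is enlarged by
-- adjoining an arbitrary set I of fresh points, all of which realise one
-- "generic type": a fresh point lies in an atom p exactly when p is Large,
-- where Large P means (classically) that P has two points and either its
-- complement is a subsingleton or P contains a fixed base point a₀.
--
-- Three points make the carrier Roomy: it is not the union of two
-- subsingletons.  In a roomy set, Large is monotone, is refuted by
-- subsingletons, is forced by co-subsingletons, and commutes with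
-- complement.  These facts show that an old point satisfies an e-term in
-- the enlarged structure iff it did in 𝔄, and a fresh point satisfies the
-- e-term e iff the set e^𝔄 is Large (for ∀ℓ: iff ℓ^𝔄 is empty).  Hence
-- ∀(e,f) transfers by monotonicity of Large and ∃(e,f) by its old witness.
-- Adjoining ℕ fresh points yields models of every finite size.
--
-- Everything is constructive: classical facts are stated under ¬¬.

open import Defs
open import Data.Fin using (Fin; toℕ)
open import Data.Fin.Properties using (toℕ-injective)
open import Data.Nat using (ℕ)
open import Data.Product using (Σ; _×_; _,_)
open import Data.Sum using (_⊎_; inj₁; inj₂)
import Data.Sum as Sum
open import Data.Sum.Properties using (inj₁-injective; inj₂-injective)
open import Data.Empty using (⊥; ⊥-elim)
open import Function using (_∘_)
open import Function.Bundles using (_⇔_; mk⇔; Equivalence)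
open import Function.Construct.Identity using (⇔-id)
open import Function.Construct.Symmetry using (⇔-sym)
open import Function.Construct.Composition using (_⇔-∘_)
open import Function.Definitions using (Injective)
open import Function.Related.TypeIsomorphisms using (¬-cong-⇔)
open import Relation.Nullary using (¬_; yes; no)
open import Relation.Nullary.Decidable.Core using (¬¬-excluded-middle)
open import Relation.Binary.PropositionalEquality using (_≡_; sym; trans; cong)

open Equivalence using (to; from)

private
  variable
    A : Set
    P Q : A → Set

_⊆_ : (A → Set) → (A → Set) → Set
P ⊆ Q = ∀ a → P a → Q a

∁ : (A → Set) → A → Set
∁ P a = ¬ P a

∁-antimono : P ⊆ Q → ∁ Q ⊆ ∁ P
∁-antimono P⊆Q a ¬qa pa = ¬qa (P⊆Q a pa)

TwoPoints : (A → Set) → Set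
TwoPoints {A} P = Σ A λ a → Σ A λ b → ¬ a ≡ b × P a × P b

-- P is a subsingleton, in the ¬¬-stable form "no two distinct points".
Small : (A → Set) → Set
Small P = ¬ TwoPoints P

-- The empty predicate, and the points equal to every point of Q; the
-- latter is the meaning of the e-term ∀ℓ with Q = ℓ^𝔄.
Empty : (A → Set) → Set
Empty P = ∀ a → ¬ P a

Only : (A → Set) → A → Set
Only Q a = ∀ b → Q b → a ≡ b

TwoPoints-mono : P ⊆ Q → TwoPoints P → TwoPoints Q
TwoPoints-mono P⊆Q (a , b , a≢b , pa , pb) = a , b , a≢b , P⊆Q a pa , P⊆Q b pb

Small-antimono : P ⊆ Q → Small Q → Small P
Small-antimono P⊆Q smallQ = smallQ ∘ TwoPoints-mono P⊆Q

TwoPoints-¬¬ : TwoPoints (∁ (∁ P)) → ¬ ¬ TwoPoints P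
TwoPoints-¬¬ (a , b , a≢b , ¬¬pa , ¬¬pb) k = ¬¬pa λ pa → ¬¬pb λ pb → k (a , b , a≢b , pa , pb)

Small-¬¬ : Small P → Small (∁ (∁ P))
Small-¬¬ smallP two = TwoPoints-¬¬ two smallP

Empty⇒Small : Empty P → Small P
Empty⇒Small empty (a , _ , _ , pa , _) = empty a pa

Small-⊆-singleton : (c : A) → P ⊆ (_≡ c) → Small P
Small-⊆-singleton c P⊆c (a , b , a≢b , pa , pb) = a≢b (trans (P⊆c a pa) (sym (P⊆c b pb)))

-- A set is Roomy when no subsingleton has a subsingleton complement;
-- classically this says that it has at least three points.
Roomy : Set → Set₁
Roomy A = (P : A → Set) → Small P → ¬ Small (∁ P)

-- Pigeonhole: of three distinct points two lie on the same side of P.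
three-points-Roomy : (a b c : A) → ¬ a ≡ b → ¬ a ≡ c → ¬ b ≡ c → Roomy A
three-points-Roomy a b c a≢b a≢c b≢c P smallP small∁P = ¬¬-excluded-middle λ
  { (yes pa) → small∁P (b , c , b≢c , (λ pb → smallP (a , b , a≢b , pa , pb))
                                    , (λ pc → smallP (a , c , a≢c , pa , pc)))
  ; (no ¬pa) → TwoPoints-¬¬ (b , c , b≢c , (λ ¬pb → small∁P (a , b , a≢b , ¬pa , ¬pb))
                                         , (λ ¬pc → small∁P (a , c , a≢c , ¬pa , ¬pc))) smallP
  }

module Largeness {A : Set} (a₀ : A) (roomy : Roomy A) where

  Large : (A → Set) → Set
  Large P = ¬ ¬ (TwoPoints P × (Small (∁ P) ⊎ P a₀))

  Small⇒¬Large : Small P → ¬ Large P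
  Small⇒¬Large smallP large = large λ (twoP , _) → smallP twoP

  -- Roomyness supplies the two points of P when ∁ P is small.
  co-Small⇒Large : Small (∁ P) → Large P
  co-Small⇒Large {P} small∁P k =
    roomy (∁ P) small∁P λ two∁∁P → TwoPoints-¬¬ two∁∁P λ twoP → k (twoP , inj₁ small∁P)

  -- Monotonicity is what transfers universal formulas ∀(e,f) to fresh points.
  Large-mono : P ⊆ Q → Large P → Large Q
  Large-mono P⊆Q large k = large λ (twoP , side) →
    k (TwoPoints-mono P⊆Q twoP , Sum.map (Small-antimono (∁-antimono P⊆Q)) (P⊆Q a₀) side)

  -- Exactly one of P, ∁ P is large; this interprets negative literals.
  Large-∁⇒¬Large : Large (∁ P) → ¬ Large P
  Large-∁⇒¬Large {P} large∁P largeP =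
    large∁P λ (two∁P , side∁) → largeP λ (twoP , side) → clash two∁P twoP side∁ side
    where
    clash : TwoPoints (∁ P) → TwoPoints P → Small (∁ (∁ P)) ⊎ ∁ P a₀ → Small (∁ P) ⊎ P a₀ → ⊥
    clash two∁P _    _                  (inj₁ small∁P) = small∁P two∁P
    clash _     twoP (inj₁ small∁∁P)    _              = small∁∁P (TwoPoints-mono (λ a pa ¬pa → ¬pa pa) twoP)
    clash _     _    (inj₂ ¬pa₀)        (inj₂ pa₀)     = ¬pa₀ pa₀

  -- If P is not large, then ∁ P is not small (so ¬¬ has two points), and
  -- P itself is small whenever a₀ ∈ P.
  ¬Large⇒Large-∁ : ¬ Large P → Large (∁ P)
  ¬Large⇒Large-∁ {P} ¬largeP k = two∁P λ two → ¬¬-excluded-middle λ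
    { (yes pa₀) → k (two , inj₁ (Small-¬¬ (small-if-based pa₀)))
    ; (no ¬pa₀) → k (two , inj₂ ¬pa₀)
    }
    where
    two∁P : ¬ ¬ TwoPoints (∁ P)
    two∁P = ¬largeP ∘ co-Small⇒Large
    small-if-based : P a₀ → Small P
    small-if-based pa₀ twoP = ¬largeP λ k′ → k′ (twoP , inj₂ pa₀)

  Large-∁ : Large (∁ P) ⇔ (¬ Large P)
  Large-∁ = mk⇔ Large-∁⇒¬Large ¬Large⇒Large-∁

  -- ∀Q is everything when Q is empty and a subsingleton otherwise.
  Large-Only : Large (Only Q) ⇔ Empty Q
  Large-Only {Q} = mk⇔ large⇒empty empty⇒large
    where
    large⇒empty : Large (Only Q) → Empty Q
    large⇒empty large b qb = Small⇒¬Large (Small-⊆-singleton b (λ a only → only b qb)) large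
    empty⇒large : Empty Q → Large (Only Q)
    empty⇒large empty = co-Small⇒Large λ (_ , _ , _ , ¬only , _) → ¬only λ b qb → ⊥-elim (empty b qb)

module Extension (𝔄 : Structure) (roomy : Roomy (Carrier 𝔄)) (I : Set) where
  open Largeness (inhabitant 𝔄) roomy

  interp⁺ : Atom → Carrier 𝔄 ⊎ I → Set
  interp⁺ p (inj₁ a) = interp 𝔄 p a
  interp⁺ p (inj₂ _) = Large (interp 𝔄 p)

  𝔄⁺ : Structure
  𝔄⁺ = record { Carrier = Carrier 𝔄 ⊎ I ; inhabitant = inj₁ (inhabitant 𝔄) ; interp = interp⁺ }

  lit-old : ∀ ℓ a → litI 𝔄⁺ ℓ (inj₁ a) ⇔ litI 𝔄 ℓ a
  lit-old (pos p) a = ⇔-id _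
  lit-old (neg p) a = ⇔-id _

  lit-new : ∀ ℓ i → litI 𝔄⁺ ℓ (inj₂ i) ⇔ Large (litI 𝔄 ℓ)
  lit-new (pos p) i = ⇔-id _
  lit-new (neg p) i = ⇔-sym Large-∁

  -- An old point of ∀ℓ forces ℓ^𝔄 to be small, so no fresh point lies in ℓ.
  Only-old : ∀ ℓ a → Only (litI 𝔄⁺ ℓ) (inj₁ a) ⇔ Only (litI 𝔄 ℓ) a
  Only-old ℓ a = mk⇔ restrict extend
    where
    restrict : Only (litI 𝔄⁺ ℓ) (inj₁ a) → Only (litI 𝔄 ℓ) a
    restrict only b ℓb = inj₁-injective (only (inj₁ b) (from (lit-old ℓ b) ℓb))
    extend : Only (litI 𝔄 ℓ) a → Only (litI 𝔄⁺ ℓ) (inj₁ a)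
    extend only (inj₁ b) ℓb = cong inj₁ (only b (to (lit-old ℓ b) ℓb))
    extend only (inj₂ i) ℓi =
      ⊥-elim (Small⇒¬Large (Small-⊆-singleton a (λ b ℓb → sym (only b ℓb))) (to (lit-new ℓ i) ℓi))

  Only-new : ∀ ℓ i → Only (litI 𝔄⁺ ℓ) (inj₂ i) ⇔ Empty (litI 𝔄 ℓ)
  Only-new ℓ i = mk⇔ restrict extend
    where
    restrict : Only (litI 𝔄⁺ ℓ) (inj₂ i) → Empty (litI 𝔄 ℓ)
    restrict only b ℓb with only (inj₁ b) (from (lit-old ℓ b) ℓb)
    ... | ()
    extend : Empty (litI 𝔄 ℓ) → Only (litI 𝔄⁺ ℓ) (inj₂ i)
    extend empty (inj₁ b) ℓb = ⊥-elim (empty b (to (lit-old ℓ b) ℓb))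
    extend empty (inj₂ j) ℓj = ⊥-elim (Small⇒¬Large (Empty⇒Small empty) (to (lit-new ℓ j) ℓj))

  eterm-old : ∀ e a → etermI 𝔄⁺ e (inj₁ a) ⇔ etermI 𝔄 e a
  eterm-old (lit ℓ)   a = lit-old ℓ a
  eterm-old (all ℓ)   a = Only-old ℓ a
  eterm-old (noall ℓ) a = ¬-cong-⇔ (Only-old ℓ a)

  eterm-new : ∀ e i → etermI 𝔄⁺ e (inj₂ i) ⇔ Large (etermI 𝔄 e)
  eterm-new (lit ℓ)   i = lit-new ℓ i
  eterm-new (all ℓ)   i = ⇔-sym Large-Only ⇔-∘ Only-new ℓ i
  eterm-new (noall ℓ) i = ⇔-sym Large-∁ ⇔-∘ ¬-cong-⇔ (eterm-new (all ℓ) i)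

  -- ∀(e,f) holds at fresh points since Large is monotone; ∃ keeps its witness.
  preserves : (φ : Formula) → 𝔄 ⊨ φ → 𝔄⁺ ⊨ φ
  preserves (forallF e f) e⊆f (inj₁ a) ea = from (eterm-old f a) (e⊆f a (to (eterm-old e a) ea))
  preserves (forallF e f) e⊆f (inj₂ i) ei = from (eterm-new f i) (Large-mono e⊆f (to (eterm-new e i) ei))
  preserves (existsF e f) (a , ea , fa)   = inj₁ a , from (eterm-old e a) ea , from (eterm-old f a) fa

  fresh-AtLeast : ∀ {n} (fresh : Fin n → I) → Injective _≡_ _≡_ fresh → AtLeast n 𝔄⁺
  fresh-AtLeast fresh fresh-inj = inj₂ ∘ fresh , fresh-inj ∘ inj₂-injective

theorem7p11 : (Φ : FormulaSet) →
    Σ Structure (λ 𝔄 → IsModel 𝔄 Φ × ThreeOrMore 𝔄) →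
    (n : ℕ) → Σ Structure (λ 𝔅 → IsModel 𝔅 Φ × AtLeast n 𝔅)
theorem7p11 Φ (𝔄 , 𝔄⊨Φ , (a , b , c , a≢b , a≢c , b≢c)) n =
  𝔄⁺ , (λ φ φ∈Φ → preserves φ (𝔄⊨Φ φ φ∈Φ)) , fresh-AtLeast toℕ toℕ-injective
  where open Extension 𝔄 (three-points-Roomy a b c a≢b a≢c b≢c) ℕ
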